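{- Let $p=(p_1,\dots,p_n)$ be a permutation and let $D(p)$ be the number of passes performed by the recursive non-resampling Disappear-Sort procedure on $p$. Let $L(p)$ denote the length of the longest decreasing subsequence of $p$. Then $D(p)=L(p)$.
   Context: A Disappear-Sort pass on a list of distinct reals scans left to right and retains exactly the left-to-right records (entries larger than all earlier entries of the list; the first entry is always retained), discarding all other entries. The recursive non-resampling procedure applies a pass to $p$, then applies a pass to the list of discarded entries (kept in their original relative order), and so on, until the list of discarded entries is empty. $D(p)$ is the number of passes performed. -}

module Defs where

open import Data.Nat using (ℕ; zero; suc; _+_; _<_; _>_; _≤_; _<ᵇ_)
open import Data.Bool using (Bool; true; false; if_then_else_)
open import Data.List using (List; []; _∷_; length; upTo; map)
open import Data.Product using (_×_; _,_; proj₁; proj₂; ∃-syntax)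
open import Data.List.Relation.Binary.Sublist.Propositional using (_⊆_)
open import Data.List.Relation.Unary.Linked using (Linked)
open import Data.List.Relation.Binary.Permutation.Propositional using (_↭_)

-- One Disappear-Sort pass, scanning with current maximum m:
-- returns (retained left-to-right records, discarded entries in order).
passFrom : ℕ → List ℕ → List ℕ × List ℕ
passFrom m [] = [] , []
passFrom m (x ∷ xs) with m <ᵇ x
... | true  = let r = passFrom x xs in (x ∷ proj₁ r) , proj₂ r
... | false = let r = passFrom m xs in proj₁ r , (x ∷ proj₂ r)

pass : List ℕ → List ℕ × List ℕ
pass [] = [] , []
pass (x ∷ xs) = let r = passFrom x xs in (x ∷ proj₁ r) , proj₂ r

-- Number of passes, with fuel (fuel = length p suffices, since each pass on a
-- nonempty list retains at least one entry).
passesFuel : ℕ → List ℕ → ℕ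
passesFuel _ [] = 0
passesFuel zero (x ∷ xs) = 0
passesFuel (suc f) (x ∷ xs) = suc (passesFuel f (proj₂ (pass (x ∷ xs))))

D : List ℕ → ℕ
D p = passesFuel (length p) p

IsDecreasingSubseq : List ℕ → List ℕ → Set
IsDecreasingSubseq s p = (s ⊆ p) × Linked _>_ s

IsLongestDecreasingLength : List ℕ → ℕ → Set
IsLongestDecreasingLength p n =
  (∃[ s ] (IsDecreasingSubseq s p × length s ≡' n)) ×
  (∀ s → IsDecreasingSubseq s p → length s ≤ n)
  where
  open import Relation.Binary.PropositionalEquality using () renaming (_≡_ to _≡'_)

IsPermutation : ℕ → List ℕ → Set
IsPermutation n p = p ↭ map suc (upTo n)

{-# OPTIONS --safe #-}
-- A pass removes exactly the first entry of any decreasing subsequence, since every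
-- later entry lies below an earlier one and so is not a record; hence L(p) ≤ D(p).
-- Conversely each discarded entry is preceded by a larger one (the running maximum
-- when it was read), so a decreasing subsequence of the discarded list extends by one
-- entry in front; iterating over the passes gives one of length D(p).
module Submission where

open import Defs
open import Data.Nat using (ℕ; suc; _<_; _>_; _≤_; _<ᵇ_; z≤n; s≤s)
open import Data.Nat.Properties
  using (<ᵇ-reflects-<; ≮⇒≥; ≤-trans; <-trans; <⇒≤; ≤∧≢⇒<; <⇒≱; ≤-refl; suc-injective)
open import Data.Bool using (true; false)
open import Data.Empty using (⊥-elim)
open import Data.List using (List; []; _∷_; [_]; length)
open import Data.List.Relation.Unary.All as All using (All; []; _∷_)
open import Data.List.Relation.Unary.Linked as Linked using (Linked; []; [-]; _∷_)
open import Data.List.Relation.Unary.Linked.Properties using (Linked⇒All)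
open import Data.List.Relation.Unary.Unique.Propositional using (Unique; _∷_)
open import Data.List.Relation.Unary.Unique.Propositional.Properties using (map⁺; upTo⁺)
open import Data.List.Relation.Binary.Sublist.Propositional
  using (_⊆_; []; _∷_; _∷ʳ_; ⊆-trans; minimum)
open import Data.List.Relation.Binary.Sublist.Propositional.Properties
  using (All-resp-⊆; length-mono-≤)
open import Data.List.Relation.Binary.Permutation.Propositional using (↭-sym; ↭⇒↭ₛ)
open import Data.List.Relation.Binary.Permutation.Setoid.Properties using (Unique-resp-↭)
open import Data.Product using (_×_; _,_; proj₂; ∃-syntax)
open import Relation.Binary.PropositionalEquality using (_≡_; refl; ≢-sym; trans; cong; setoid)
open import Relation.Nullary.Reflects using (ofʸ; ofⁿ)

discardedFrom : ℕ → List ℕ → List ℕ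
discardedFrom m xs = proj₂ (passFrom m xs)

discarded : List ℕ → List ℕ
discarded p = proj₂ (pass p)

discardedFrom-⊆ : ∀ m xs → discardedFrom m xs ⊆ xs
discardedFrom-⊆ m [] = []
discardedFrom-⊆ m (x ∷ xs) with m <ᵇ x
... | true  = x ∷ʳ discardedFrom-⊆ x xs
... | false = refl ∷ discardedFrom-⊆ m xs

discarded-shorter : ∀ y ys → length (discarded (y ∷ ys)) ≤ length ys
discarded-shorter y ys = length-mono-≤ (discardedFrom-⊆ y ys)

Unique-resp-⊆ : ∀ {xs ys : List ℕ} → xs ⊆ ys → Unique ys → Unique xs
Unique-resp-⊆ []         u        = u
Unique-resp-⊆ (_ ∷ʳ τ)   (_ ∷ u)  = Unique-resp-⊆ τ u
Unique-resp-⊆ (refl ∷ τ) (x≢ ∷ u) = All-resp-⊆ τ x≢ ∷ Unique-resp-⊆ τ u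

head-dominates : ∀ {x s} → Linked _>_ (x ∷ s) → All (_< x) s
head-dominates [-]       = []
head-dominates (x>y ∷ l) = Linked⇒All (λ a>b b>c → <-trans b>c a>b) x>y l

belowMax-discarded : ∀ {m xs s} → s ⊆ xs → All (_≤ m) s → s ⊆ discardedFrom m xs
belowMax-discarded [] [] = []
belowMax-discarded {m} {x ∷ xs} (.x ∷ʳ τ) s≤m with m <ᵇ x | <ᵇ-reflects-< m x
... | true  | ofʸ m<x = belowMax-discarded τ (All.map (λ y≤m → ≤-trans y≤m (<⇒≤ m<x)) s≤m)
... | false | ofⁿ _   = x ∷ʳ belowMax-discarded τ s≤m
belowMax-discarded {m} {x ∷ xs} (refl ∷ τ) (x≤m ∷ s≤m) with m <ᵇ x | <ᵇ-reflects-< m x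
... | true  | ofʸ m<x = ⊥-elim (<⇒≱ m<x x≤m)
... | false | ofⁿ _   = refl ∷ belowMax-discarded τ s≤m

afterHead-discardedFrom : ∀ m {xs x s} → (x ∷ s) ⊆ xs → All (_≤ x) s → s ⊆ discardedFrom m xs
afterHead-discardedFrom m {y ∷ xs} (.y ∷ʳ τ) s≤x with m <ᵇ y
... | true  = afterHead-discardedFrom y τ s≤x
... | false = y ∷ʳ afterHead-discardedFrom m τ s≤x
afterHead-discardedFrom m {x ∷ xs} (refl ∷ τ) s≤x with m <ᵇ x | <ᵇ-reflects-< m x
... | true  | ofʸ _   = belowMax-discarded τ s≤x
... | false | ofⁿ m≮x = x ∷ʳ belowMax-discarded τ (All.map (λ y≤x → ≤-trans y≤x (≮⇒≥ m≮x)) s≤x)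

afterHead-discarded : ∀ {p x s} → (x ∷ s) ⊆ p → All (_≤ x) s → s ⊆ discarded p
afterHead-discarded {y ∷ ys} (.y ∷ʳ τ) s≤x = afterHead-discardedFrom y τ s≤x
afterHead-discarded {x ∷ xs} (refl ∷ τ) s≤x = belowMax-discarded τ s≤x

decreasing-length≤passesFuel : ∀ f p → length p ≤ f →
  ∀ {s} → IsDecreasingSubseq s p → length s ≤ passesFuel f p
decreasing-length≤passesFuel f       p        _          {[]}    _ = z≤n
decreasing-length≤passesFuel f       []       _          {_ ∷ _} (() , _)
decreasing-length≤passesFuel (suc f) (y ∷ ys) (s≤s ys≤f) {x ∷ s} (τ , l) =
  s≤s (decreasing-length≤passesFuel f (discarded (y ∷ ys)) (≤-trans (discarded-shorter y ys) ys≤f)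
        (afterHead-discarded τ (All.map <⇒≤ (head-dominates l)) , Linked.tail l))

discardedFrom-dominated : ∀ m xs {y s} → (y ∷ s) ⊆ discardedFrom m xs →
  ∃[ z ] (y ≤ z × (z ∷ y ∷ s) ⊆ (m ∷ xs))
discardedFrom-dominated m (x ∷ xs) τ with m <ᵇ x | <ᵇ-reflects-< m x
discardedFrom-dominated m (x ∷ xs) τ          | true  | _ with discardedFrom-dominated x xs τ
... | z , y≤z , σ = z , y≤z , m ∷ʳ σ
discardedFrom-dominated m (x ∷ xs) (.x ∷ʳ τ) | false | _ with discardedFrom-dominated m xs τ
... | z , y≤z , refl ∷ σ = z , y≤z , refl ∷ x ∷ʳ σ
... | z , y≤z , .m ∷ʳ σ  = z , y≤z , m ∷ʳ x ∷ʳ σ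
discardedFrom-dominated m (x ∷ xs) (refl ∷ τ) | false | ofⁿ m≮x =
  m , ≮⇒≥ m≮x , refl ∷ refl ∷ ⊆-trans τ (discardedFrom-⊆ m xs)

discarded-dominated : ∀ {p y s} → Unique p → (y ∷ s) ⊆ discarded p →
  ∃[ z ] (z > y × (z ∷ y ∷ s) ⊆ p)
discarded-dominated {x ∷ xs} u τ with discardedFrom-dominated x xs τ
... | z , y≤z , σ with Unique-resp-⊆ σ u
...   | (z≢y ∷ _) ∷ _ = z , ≤∧≢⇒< y≤z (≢-sym z≢y) , σ

decreasing-extend : ∀ {y ys s} → Unique (y ∷ ys) → IsDecreasingSubseq s (discarded (y ∷ ys)) →
  ∃[ t ] (IsDecreasingSubseq t (y ∷ ys) × length t ≡ suc (length s))
decreasing-extend {y} {ys} {[]}    _ _       = [ y ] , (refl ∷ minimum ys , [-]) , refl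
decreasing-extend {s = x ∷ s}      u (τ , l) with discarded-dominated u τ
... | z , z>x , σ = z ∷ x ∷ s , (σ , z>x ∷ l) , refl

decreasing-length≡passesFuel : ∀ f p → length p ≤ f → Unique p →
  ∃[ s ] (IsDecreasingSubseq s p × length s ≡ passesFuel f p)
decreasing-length≡passesFuel f       []       _          _ = [] , ([] , []) , refl
decreasing-length≡passesFuel (suc f) (y ∷ ys) (s≤s ys≤f) u
  with decreasing-length≡passesFuel f (discarded (y ∷ ys)) (≤-trans (discarded-shorter y ys) ys≤f)
         (Unique-resp-⊆ (y ∷ʳ discardedFrom-⊆ y ys) u)
... | s , d , s≡ with decreasing-extend u d
...   | t , d′ , t≡ = t , d′ , trans t≡ (cong suc s≡)

permutation-unique : ∀ n p → IsPermutation n p → Unique p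
permutation-unique n p p↭ =
  Unique-resp-↭ (setoid ℕ) (↭⇒↭ₛ (↭-sym p↭)) (map⁺ suc-injective (upTo⁺ n))

mainTheorem5 : (n : ℕ) (p : List ℕ) → IsPermutation n p → IsLongestDecreasingLength p (D p)
mainTheorem5 n p p↭ =
  decreasing-length≡passesFuel (length p) p ≤-refl (permutation-unique n p p↭) ,
  λ s → decreasing-length≤passesFuel (length p) p ≤-refl
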